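{- Let $p,k$ be positive integers, $n=p+k$, and $\mathcal L\subseteq[n]$. Let $\overrightarrow{L}_{p,k,\mathcal L}$ be the digraph on $[n]$ with arc set $\{(i,i+1),(i+1,i): i\in[p]\}\cup\{(i,j),(j,i): p+1\le i<j\le n\}\cup\{(\ell,\ell):\ell\in\mathcal L\}$. If $[p+2]\subseteq\mathcal L$, then $\overrightarrow{L}_{p,k,\mathcal L}$ requires the nSSP.
   Context: A digraph $G$ has vertex set $[n]$ and arc set $E(G)\subseteq[n]\times[n]$ (arcs $(v,v)$ are loops). $\mathcal M(G)$ is the set of real $n\times n$ matrices $A=(a_{ij})$ with $a_{ij}\ne0$ iff $(i,j)\in E(G)$. A real matrix $A$ has the nSSP if the only real $X$ with $A\circ X=O$ (entrywise product) and $AX^\top-X^\top A=O$ is $X=O$; $G$ requires the nSSP if every $A\in\mathcal M(G)$ has the nSSP. -}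

module Defs where

open import Level using (Level; _⊔_) renaming (suc to lsuc)
open import Data.Nat as ℕ using (ℕ; suc)
open import Data.Fin using (Fin; toℕ)
open import Data.Fin.Subset using (Subset; _∈_)
open import Data.Product using (_×_; Σ; ∃; _,_)
open import Data.Sum using (_⊎_)
open import Relation.Binary.PropositionalEquality using (_≡_)
open import Relation.Nullary using (¬_)
open import Relation.Unary using (Pred)
open import Function.Bundles using (_⇔_)
open import Algebra.Bundles using (CommutativeRing)
open import Relation.Binary.Structures using (IsStrictTotalOrder)

-- The real numbers: no model exists in agda-stdlib, so we quantify over
-- every complete ordered field (axioms of ℝ; all models are isomorphic).

record RealField (c ℓ : Level) : Set (lsuc (c ⊔ ℓ)) where
  field
    commutativeRing : CommutativeRing c ℓ
  open CommutativeRing commutativeRing public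
  field
    _<_            : Carrier → Carrier → Set ℓ
    isStrictTotalOrder : IsStrictTotalOrder _≈_ _<_
    _⁻¹            : (x : Carrier) → ¬ (x ≈ 0#) → Carrier
    inverseˡ       : ∀ x (x≉0 : ¬ (x ≈ 0#)) → ((x ⁻¹) x≉0) * x ≈ 1#
    0≉1            : ¬ (0# ≈ 1#)
    +-mono-<       : ∀ x y z → x < y → (x + z) < (y + z)
    *-pos          : ∀ x y → 0# < x → 0# < y → 0# < (x * y)
    sup            : ∀ (S : Pred Carrier ℓ) → Σ Carrier S →
                     Σ Carrier (λ b → ∀ x → S x → ¬ (b < x)) →
                     Σ Carrier (λ s → (∀ x → S x → ¬ (s < x)) ×
                                      (∀ b → (∀ x → S x → ¬ (b < x)) → ¬ (b < s)))

module Matrices {c ℓ : Level} (R : RealField c ℓ) where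
  open RealField R

  Matrix : ℕ → Set c
  Matrix n = Fin n → Fin n → Carrier

  ∑ : ∀ {n} → (Fin n → Carrier) → Carrier
  ∑ {ℕ.zero} f = 0#
  ∑ {suc n}  f = f Data.Fin.zero + ∑ (λ i → f (Data.Fin.suc i))

  _·_ : ∀ {n} → Matrix n → Matrix n → Matrix n
  (A · B) i j = ∑ (λ l → A i l * B l j)

  _ᵀ : ∀ {n} → Matrix n → Matrix n
  (A ᵀ) i j = A j i

  InPattern : ∀ {n} → (Fin n → Fin n → Set) → Matrix n → Set (ℓ ⊔ Level.zero)
  InPattern E A = ∀ i j → (¬ (A i j ≈ 0#)) ⇔ E i j

  nSSP : ∀ {n} → Matrix n → Set (c ⊔ ℓ)
  nSSP {n} A = ∀ (X : Matrix n) →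
    (∀ i j → A i j * X i j ≈ 0#) →
    (∀ i j → ((A · (X ᵀ)) i j - ((X ᵀ) · A) i j) ≈ 0#) →
    ∀ i j → X i j ≈ 0#

  RequiresNSSP : ∀ {n} → (Fin n → Fin n → Set) → Set (c ⊔ ℓ)
  RequiresNSSP {n} E = ∀ (A : Matrix n) → InPattern E A → nSSP A

-- The digraph L→_{p,k,𝓛} on [n], n = p + k.  Vertex i : Fin n stands for
-- the integer toℕ i + 1 ∈ [n]; below a, b are these 1-based labels.

LArcℕ : (p n : ℕ) → (ℕ → Set) → ℕ → ℕ → Set
LArcℕ p n inL a b =
    (1 ℕ.≤ a × a ℕ.≤ p × b ≡ suc a)
  ⊎ (1 ℕ.≤ b × b ℕ.≤ p × a ≡ suc b)
  ⊎ (suc p ℕ.≤ a × a ℕ.< b × b ℕ.≤ n)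
  ⊎ (suc p ℕ.≤ b × b ℕ.< a × a ℕ.≤ n)
  ⊎ (a ≡ b × inL a)

LDigraph : (p k : ℕ) → Subset (p ℕ.+ k) → Fin (p ℕ.+ k) → Fin (p ℕ.+ k) → Set
LDigraph p k 𝓛 i j =
  LArcℕ p (p ℕ.+ k) (λ a → ∃ λ (v : Fin (p ℕ.+ k)) → suc (toℕ v) ≡ a × v ∈ 𝓛)
        (suc (toℕ i)) (suc (toℕ j))

module Submission where

-- Let A Xᵀ = Xᵀ A and A ∘ X = O. Then X vanishes on the arcs: off the diagonal of the clique
-- [p+1, n] and on the loops [p+2]. Entry (a, b) of A Xᵀ = Xᵀ A reads
-- Σₗ a_al x_bl = Σₗ x_la a_lb; whenever every term but one a_au x_bu with a_au ≠ 0 is known to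
-- vanish, x_bu = 0. With a = p + 2 this kills the rest of the clique diagonal, so X = O on
-- [p+1, n]². Going down the path, if X = O on [m+1, n]², then x_mm, x_m(m+1), x_(m+1)m lie on
-- arcs and, for v ≥ m + 2, a = m + 1 isolates x_vm; x_mv follows from the transposed pair
-- (Aᵀ, Xᵀ), which satisfies the same hypotheses because the digraph is symmetric.

open import Defs
open import Level using (Level)
import Data.Nat as Nat
open Nat using (ℕ; suc; _≤_; _<_; z≤n; s≤s; _≤?_; _<?_)
import Data.Fin as F
open F using (Fin; toℕ; fromℕ<; _≟_)
open import Data.Fin.Subset using (Subset; _∈_)
open import Data.Nat.Properties
  using (≤-trans; ≤-reflexive; <-trans; ≤-<-trans; <⇒≤; <⇒≱; 1+n≰n; n≤1+n; m≤n⇒m≤1+n;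
         m+n≤o⇒n≤o; m<n+m; +-comm; +-suc; <-cmp; ≰⇒>; ≮⇒≥; m≤n⇒m<n∨m≡n)
import Data.Nat.Properties as ℕₚ
open import Data.Fin.Properties using (toℕ<n; toℕ-fromℕ<; toℕ-injective; punchInᵢ≢i)
open import Data.Vec.Functional using (removeAt)
open import Data.Product using (Σ; ∃; _×_; _,_)
open import Data.Sum using (_⊎_; inj₁; inj₂; map₁; map₂)
open import Data.Empty using (⊥-elim)
open import Function.Bundles using (Equivalence; mk⇔)
open import Relation.Binary.Definitions using (tri<; tri≈; tri>)
open import Relation.Binary.Structures using (IsStrictTotalOrder)
open import Relation.Binary.PropositionalEquality as ≡ using (_≡_; _≢_)
open import Relation.Nullary using (¬_; yes; no)
open import Relation.Nullary.Decidable using (decidable-stable)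
import Algebra.Properties.Group as GroupProperties
import Algebra.Properties.Semiring.Sum as SemiringSum
import Relation.Binary.Reasoning.Setoid as SetoidReasoning

module Candidates {c ℓ : Level} (ℝ : RealField c ℓ) where

  open RealField ℝ renaming (sym to ≈-sym; trans to ≈-trans; reflexive to ≈-reflexive)
  open Matrices ℝ
  open SemiringSum semiring using (sum; sum-cong-≋; sum-replicate-zero; sum-remove)
  open SetoidReasoning setoid

  x≈0∨y≈0⇒x*y≈0 : ∀ {x y} → x ≈ 0# ⊎ y ≈ 0# → x * y ≈ 0#
  x≈0∨y≈0⇒x*y≈0 {x} {y} (inj₁ x≈0) = ≈-trans (*-congʳ x≈0) (zeroˡ y)
  x≈0∨y≈0⇒x*y≈0 {x} {y} (inj₂ y≈0) = ≈-trans (*-congˡ y≈0) (zeroʳ x)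

  x*y≈0⇒y≈0 : ∀ {x y} → ¬ x ≈ 0# → x * y ≈ 0# → y ≈ 0#
  x*y≈0⇒y≈0 {x} {y} x≉0 xy≈0 = begin
    y                    ≈⟨ ≈-sym (*-identityˡ y) ⟩
    1# * y               ≈⟨ *-congʳ (≈-sym (inverseˡ x x≉0)) ⟩
    (x ⁻¹) x≉0 * x * y   ≈⟨ *-assoc _ x y ⟩
    (x ⁻¹) x≉0 * (x * y) ≈⟨ *-congˡ xy≈0 ⟩
    (x ⁻¹) x≉0 * 0#      ≈⟨ zeroʳ _ ⟩
    0#                   ∎

  ≈0-stable : ∀ {x} → ¬ ¬ x ≈ 0# → x ≈ 0#
  ≈0-stable {x} = decidable-stable (IsStrictTotalOrder._≟_ isStrictTotalOrder x 0#)

  ∑≡sum : ∀ {n} (f : Fin n → Carrier) → ∑ f ≡ sum f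
  ∑≡sum {Nat.zero} f = ≡.refl
  ∑≡sum {suc _}    f = ≡.cong (f F.zero +_) (∑≡sum (λ l → f (F.suc l)))

  sum-zero : ∀ {n} (f : Fin n → Carrier) → (∀ l → f l ≈ 0#) → sum f ≈ 0#
  sum-zero {n} f f≈0 = ≈-trans (sum-cong-≋ f≈0) (sum-replicate-zero n)

  ∑-zero : ∀ {n} (f : Fin n → Carrier) → (∀ l → f l ≈ 0#) → ∑ f ≈ 0#
  ∑-zero f f≈0 = ≈-trans (≈-reflexive (∑≡sum f)) (sum-zero f f≈0)

  ∑-single : ∀ {n} (f : Fin n → Carrier) u → (∀ l → l ≢ u → f l ≈ 0#) → ∑ f ≈ f u
  ∑-single {suc _} f u f≈0 = begin
    ∑ f                       ≡⟨ ∑≡sum f ⟩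
    sum f                     ≈⟨ sum-remove f ⟩
    f u + sum (removeAt f u)  ≈⟨ +-congˡ (sum-zero (removeAt f u) (λ l → f≈0 _ (punchInᵢ≢i u l))) ⟩
    f u + 0#                  ≈⟨ +-identityʳ (f u) ⟩
    f u                       ∎

  ∑-cong : ∀ {n} (f g : Fin n → Carrier) → (∀ l → f l ≈ g l) → ∑ f ≈ ∑ g
  ∑-cong f g f≈g = begin
    ∑ f    ≡⟨ ∑≡sum f ⟩
    sum f  ≈⟨ sum-cong-≋ f≈g ⟩
    sum g  ≡⟨ ∑≡sum g ⟨
    ∑ g    ∎

  ∑-isolated : ∀ {n} (f g : Fin n → Carrier) u → ∑ f ≈ ∑ g →
               (∀ l → l ≢ u → f l ≈ 0#) → (∀ l → g l ≈ 0#) → f u ≈ 0#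
  ∑-isolated f g u ∑f≈∑g f≈0 g≈0 = begin
    f u  ≈⟨ ≈-sym (∑-single f u f≈0) ⟩
    ∑ f  ≈⟨ ∑f≈∑g ⟩
    ∑ g  ≈⟨ ∑-zero g g≈0 ⟩
    0#   ∎

  record Candidate {n} (A X : Matrix n) : Set ℓ where
    field
      annihilates : ∀ i j → A i j * X i j ≈ 0#
      commutes    : ∀ i j → (A · (X ᵀ)) i j ≈ ((X ᵀ) · A) i j

  transpose-candidate : ∀ {n} {A X : Matrix n} → Candidate A X → Candidate (A ᵀ) (X ᵀ)
  transpose-candidate {A = A} {X} cand = record
    { annihilates = λ i j → annihilates j i
    ; commutes    = λ i j → begin
        ∑ (λ l → A l i * X l j)  ≈⟨ ∑-cong _ _ (λ l → *-comm (A l i) (X l j)) ⟩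
        ∑ (λ l → X l j * A l i)  ≈⟨ commutes j i ⟨
        ∑ (λ l → A j l * X i l)  ≈⟨ ∑-cong _ _ (λ l → *-comm (A j l) (X i l)) ⟩
        ∑ (λ l → X i l * A j l)  ∎
    }
    where open Candidate cand

  candidate : ∀ {n} {A X : Matrix n} → (∀ i j → A i j * X i j ≈ 0#) →
              (∀ i j → ((A · (X ᵀ)) i j - ((X ᵀ) · A) i j) ≈ 0#) → Candidate A X
  candidate A∘X≈O [A,Xᵀ]≈O = record
    { annihilates = A∘X≈O
    ; commutes    = λ i j → x∙y⁻¹≈ε⇒x≈y _ _ ([A,Xᵀ]≈O i j)
    }
    where open GroupProperties +-group using (x∙y⁻¹≈ε⇒x≈y)

  module _ {n} {E : Fin n → Fin n → Set} {A : Matrix n} (A∈E : InPattern E A) where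

    arc⇒≉0 : ∀ {i j} → E i j → ¬ A i j ≈ 0#
    arc⇒≉0 = Equivalence.from (A∈E _ _)

    ¬arc⇒≈0 : ∀ {i j} → ¬ E i j → A i j ≈ 0#
    ¬arc⇒≈0 ¬e = ≈0-stable (λ A≉0 → ¬e (Equivalence.to (A∈E _ _) A≉0))

    transpose-pattern : (∀ {i j} → E i j → E j i) → InPattern E (A ᵀ)
    transpose-pattern E-sym i j =
      mk⇔ (λ A≉0 → E-sym (Equivalence.to (A∈E j i) A≉0)) (λ e → Equivalence.from (A∈E j i) (E-sym e))

    module _ {X : Matrix n} (cand : Candidate A X) where
      open Candidate cand

      arc⇒X≈0 : ∀ {i j} → E i j → X i j ≈ 0#
      arc⇒X≈0 e = x*y≈0⇒y≈0 (arc⇒≉0 e) (annihilates _ _)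

      -- Read off entry (a, b) of A Xᵀ = Xᵀ A.
      isolated⇒X≈0 : ∀ {a b u} → E a u →
                     (∀ l → l ≢ u → ¬ E a l ⊎ X b l ≈ 0#) →
                     (∀ l → X l a ≈ 0# ⊎ ¬ E l b) →
                     X b u ≈ 0#
      isolated⇒X≈0 {a} {b} {u} e left right = x*y≈0⇒y≈0 (arc⇒≉0 e)
        (∑-isolated (λ l → A a l * X b l) (λ l → X l a * A l b) u (commutes a b)
          (λ l l≢u → x≈0∨y≈0⇒x*y≈0 (map₁ ¬arc⇒≈0 (left l l≢u)))
          (λ l → x≈0∨y≈0⇒x*y≈0 (map₂ ¬arc⇒≈0 (right l))))

open Nat using (_+_)

LArcℕ-sym : ∀ {p n inL a b} → LArcℕ p n inL a b → LArcℕ p n inL b a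
LArcℕ-sym (inj₁ arc)                                 = inj₂ (inj₁ arc)
LArcℕ-sym (inj₂ (inj₁ arc))                          = inj₁ arc
LArcℕ-sym (inj₂ (inj₂ (inj₁ arc)))                   = inj₂ (inj₂ (inj₂ (inj₁ arc)))
LArcℕ-sym (inj₂ (inj₂ (inj₂ (inj₁ arc))))            = inj₂ (inj₂ (inj₁ arc))
LArcℕ-sym (inj₂ (inj₂ (inj₂ (inj₂ (≡.refl , a∈L))))) = inj₂ (inj₂ (inj₂ (inj₂ (≡.refl , a∈L))))

LArcℕ-far : ∀ {p n inL a b} → a ≤ p → 2 + a ≤ b → ¬ LArcℕ p n inL a b
LArcℕ-far _   a+2≤b (inj₁ (_ , _ , ≡.refl))                   = 1+n≰n a+2≤b
LArcℕ-far _   a+2≤b (inj₂ (inj₁ (_ , _ , ≡.refl)))            = 1+n≰n (m+n≤o⇒n≤o 2 a+2≤b)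
LArcℕ-far a≤p _     (inj₂ (inj₂ (inj₁ (p<a , _))))            = <⇒≱ p<a a≤p
LArcℕ-far _   a+2≤b (inj₂ (inj₂ (inj₂ (inj₁ (_ , b<a , _))))) = <⇒≱ b<a (m+n≤o⇒n≤o 2 a+2≤b)
LArcℕ-far _   a+2≤b (inj₂ (inj₂ (inj₂ (inj₂ (≡.refl , _)))))  = 1+n≰n (m+n≤o⇒n≤o 1 a+2≤b)

module LDigraphArcs (p k : ℕ) (𝓛 : Subset (p + k)) where

  E : Fin (p + k) → Fin (p + k) → Set
  E = LDigraph p k 𝓛

  In𝓛 : ℕ → Set
  In𝓛 a = ∃ λ (v : Fin (p + k)) → suc (toℕ v) ≡ a × v ∈ 𝓛

  E-sym : ∀ {i j} → E i j → E j i
  E-sym = LArcℕ-sym {inL = In𝓛}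

  path-arc : ∀ {i j} → toℕ i < p → toℕ j ≡ suc (toℕ i) → E i j
  path-arc i<p j≡i+1 = inj₁ (s≤s z≤n , i<p , ≡.cong suc j≡i+1)

  clique-arc : ∀ {i j} → p ≤ toℕ i → p ≤ toℕ j → i ≢ j → E i j
  clique-arc {i} {j} p≤i p≤j i≢j with <-cmp (toℕ i) (toℕ j)
  ... | tri< i<j _ _ = inj₂ (inj₂ (inj₁ (s≤s p≤i , s≤s i<j , toℕ<n j)))
  ... | tri≈ _ i≡j _ = ⊥-elim (i≢j (toℕ-injective i≡j))
  ... | tri> _ _ j<i = inj₂ (inj₂ (inj₂ (inj₁ (s≤s p≤j , s≤s j<i , toℕ<n i))))

  loop-arc : (∀ (v : Fin (p + k)) → suc (toℕ v) ≤ p + 2 → v ∈ 𝓛) →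
             ∀ {i} → toℕ i ≤ suc p → E i i
  loop-arc [p+2]⊆𝓛 {i} i≤p+1 =
    inj₂ (inj₂ (inj₂ (inj₂ (≡.refl , i , ≡.refl , [p+2]⊆𝓛 i (≤-trans (s≤s i≤p+1) (≤-reflexive (+-comm 2 p)))))))

  far-¬arc : ∀ {l j} → toℕ l < p → 2 + toℕ l ≤ toℕ j → ¬ E l j
  far-¬arc l<p l+2≤j = LArcℕ-far {inL = In𝓛} l<p (s≤s l+2≤j)

module LDigraphNSSP {c ℓ : Level} (ℝ : RealField c ℓ) (p k : ℕ) (𝓛 : Subset (p + k))
  ([p+2]⊆𝓛 : ∀ (v : Fin (p + k)) → suc (toℕ v) ≤ p + 2 → v ∈ 𝓛) where

  open RealField ℝ using (_≈_; 0#)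
  open Matrices ℝ
  open Candidates ℝ
  open LDigraphArcs p k 𝓛

  -- Vertices are counted from 0 here: the clique is toℕ i ≥ p and the loops are toℕ i ≤ p + 1.
  VanishesFrom : Matrix (p + k) → ℕ → Set ℓ
  VanishesFrom X m = ∀ i j → m ≤ toℕ i → m ≤ toℕ j → X i j ≈ 0#

  vertex-below : ∀ {m} (v : Fin (p + k)) → m < toℕ v → Σ (Fin (p + k)) λ w → toℕ w ≡ m
  vertex-below v m<v = fromℕ< (<-trans m<v (toℕ<n v)) , toℕ-fromℕ< _

  module _ {A X : Matrix (p + k)} (A∈E : InPattern E A) (cand : Candidate A X) where

    X-clique : ∀ {i j} → p ≤ toℕ i → p ≤ toℕ j → i ≢ j → X i j ≈ 0#
    X-clique p≤i p≤j i≢j = arc⇒X≈0 A∈E cand (clique-arc p≤i p≤j i≢j)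

    X-loop : ∀ {i} → toℕ i ≤ suc p → X i i ≈ 0#
    X-loop i≤p+1 = arc⇒X≈0 A∈E cand (loop-arc [p+2]⊆𝓛 i≤p+1)

    -- Beyond p + 1 there is no loop; look at entry (h, i) of A Xᵀ = Xᵀ A with h = p + 1.
    diagonal-vanishes : ∀ {i} → p ≤ toℕ i → X i i ≈ 0#
    diagonal-vanishes {i} p≤i with toℕ i ≤? suc p
    ... | yes i≤p+1 = X-loop i≤p+1
    ... | no i≰p+1 with vertex-below i (≰⇒> i≰p+1)
    ...   | h , h≡p+1 = isolated⇒X≈0 A∈E cand (clique-arc p≤h p≤i h≢i) left right
      where
        p+2≤i : suc (suc p) ≤ toℕ i
        p+2≤i = ≰⇒> i≰p+1
        p≤h : p ≤ toℕ h
        p≤h = ≤-trans (n≤1+n p) (≤-reflexive (≡.sym h≡p+1))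
        h≢i : h ≢ i
        h≢i ≡.refl = i≰p+1 (≤-reflexive h≡p+1)
        left : ∀ l → l ≢ i → ¬ E h l ⊎ X i l ≈ 0#
        left l l≢i with toℕ l <? p
        ... | yes l<p = inj₁ (λ e → far-¬arc l<p (≤-trans (s≤s l<p) (≤-reflexive (≡.sym h≡p+1))) (E-sym e))
        ... | no l≮p  = inj₂ (X-clique p≤i (≮⇒≥ l≮p) (λ i≡l → l≢i (≡.sym i≡l)))
        right : ∀ l → X l h ≈ 0# ⊎ ¬ E l i
        right l with toℕ l <? p | l ≟ h
        ... | yes l<p | _          = inj₂ (far-¬arc l<p (≤-trans (m≤n⇒m≤1+n (s≤s l<p)) p+2≤i))
        ... | no _    | yes ≡.refl = inj₁ (X-loop (≤-reflexive h≡p+1))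
        ... | no l≮p  | no l≢h     = inj₁ (X-clique (≮⇒≥ l≮p) p≤h l≢h)

    vanishes-from-p : VanishesFrom X p
    vanishes-from-p i j p≤i p≤j with i ≟ j
    ... | yes ≡.refl = diagonal-vanishes p≤i
    ... | no i≢j     = X-clique p≤i p≤j i≢j

    -- Entry (m + 1, v) of A Xᵀ = Xᵀ A: below m the path vertex m + 1 has no neighbour,
    -- and at or below m the vertex v ≥ m + 2 has none.
    column-vanishes-far : ∀ {m u v} → m < p → VanishesFrom X (suc m) → toℕ u ≡ m → 2 + m ≤ toℕ v →
                          X v u ≈ 0#
    column-vanishes-far {m} {u} {v} m<p above u≡m m+2≤v with vertex-below v m+2≤v
    ... | w , w≡m+1 = isolated⇒X≈0 A∈E cand (E-sym (path-arc u<p w≡u+1)) left right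
      where
        u<p : toℕ u < p
        u<p = ≡.subst (_< p) (≡.sym u≡m) m<p
        w≡u+1 : toℕ w ≡ suc (toℕ u)
        w≡u+1 = ≡.trans w≡m+1 (≡.cong suc (≡.sym u≡m))
        left : ∀ l → l ≢ u → ¬ E w l ⊎ X v l ≈ 0#
        left l l≢u with <-cmp (toℕ l) m
        ... | tri< l<m _ _ =
              inj₁ (λ e → far-¬arc (<-trans l<m m<p) (≤-trans (s≤s l<m) (≤-reflexive (≡.sym w≡m+1))) (E-sym e))
        ... | tri≈ _ l≡m _ = ⊥-elim (l≢u (toℕ-injective (≡.trans l≡m (≡.sym u≡m))))
        ... | tri> _ _ m<l = inj₂ (above v l (<⇒≤ m+2≤v) m<l)
        right : ∀ l → X l w ≈ 0# ⊎ ¬ E l v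
        right l with toℕ l ≤? m
        ... | yes l≤m = inj₂ (far-¬arc (≤-<-trans l≤m m<p) (≤-trans (s≤s (s≤s l≤m)) m+2≤v))
        ... | no l≰m  = inj₁ (above l w (≰⇒> l≰m) (≤-reflexive (≡.sym w≡m+1)))

    column-vanishes : ∀ {m u v} → m < p → VanishesFrom X (suc m) → toℕ u ≡ m → m ≤ toℕ v → X v u ≈ 0#
    column-vanishes {m} {u} {v} m<p above u≡m m≤v with m≤n⇒m<n∨m≡n m≤v
    ... | inj₂ m≡v with toℕ-injective (≡.trans (≡.sym m≡v) (≡.sym u≡m))
    ...   | ≡.refl = X-loop (≤-trans (≤-reflexive u≡m) (m≤n⇒m≤1+n (<⇒≤ m<p)))
    column-vanishes {m} {u} {v} m<p above u≡m m≤v | inj₁ m<v with m≤n⇒m<n∨m≡n m<v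
    ... | inj₂ m+1≡v = arc⇒X≈0 A∈E cand
                         (E-sym (path-arc (≡.subst (_< p) (≡.sym u≡m) m<p)
                                          (≡.trans (≡.sym m+1≡v) (≡.cong suc (≡.sym u≡m)))))
    ... | inj₁ m+2≤v = column-vanishes-far m<p above u≡m m+2≤v

  -- The digraph is symmetric, so (Aᵀ, Xᵀ) is again a candidate: rows of X are columns of Xᵀ.
  vanishes-step : ∀ {A X m} → InPattern E A → Candidate A X → m < p →
                  VanishesFrom X (suc m) → VanishesFrom X m
  vanishes-step A∈E cand m<p above i j m≤i m≤j with m≤n⇒m<n∨m≡n m≤i | m≤n⇒m<n∨m≡n m≤j
  ... | inj₂ m≡i | _        = column-vanishes (transpose-pattern A∈E E-sym) (transpose-candidate cand)
                                m<p (λ a b m<a m<b → above b a m<b m<a) (≡.sym m≡i) m≤j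
  ... | inj₁ _   | inj₂ m≡j = column-vanishes A∈E cand m<p above (≡.sym m≡j) m≤i
  ... | inj₁ m<i | inj₁ m<j = above i j m<i m<j

  vanishes-from : ∀ {A X} → InPattern E A → Candidate A X → ∀ d {m} → d + m ≡ p → VanishesFrom X m
  vanishes-from A∈E cand 0       ≡.refl = vanishes-from-p A∈E cand
  vanishes-from A∈E cand (suc d) {m} d+1+m≡p =
    vanishes-step A∈E cand (≡.subst (m <_) d+1+m≡p (m<n+m m (s≤s z≤n)))
      (vanishes-from A∈E cand d (≡.trans (+-suc d m) d+1+m≡p))

corollary4p2 : ∀ {c ℓ : Level} (ℝ : RealField c ℓ) (p k : ℕ) → 1 ≤ p → 1 ≤ k →
    (𝓛 : Subset (p + k)) →
    (∀ (v : Fin (p + k)) → suc (toℕ v) ≤ p + 2 → v ∈ 𝓛) →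
    Matrices.RequiresNSSP ℝ (LDigraph p k 𝓛)
corollary4p2 ℝ p k _ _ 𝓛 [p+2]⊆𝓛 A A∈E X A∘X≈O [A,Xᵀ]≈O i j =
  vanishes-from A∈E (candidate A∘X≈O [A,Xᵀ]≈O) p (ℕₚ.+-identityʳ p) i j z≤n z≤n
  where
    open Candidates ℝ using (candidate)
    open LDigraphNSSP ℝ p k 𝓛 [p+2]⊆𝓛 using (vanishes-from)
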